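{- Every s-hypersequent that is provable in the logic $\mathbf{PDBL}$ is valid in the class of all pure double Boolean algebras.
   Context: Pure double Boolean algebras. A double Boolean algebra (dBa) is an algebra $\mathbf{D}=(D,\sqcup,\sqcap,\neg,\lrcorner,\top,\bot)$ (binary $\sqcup,\sqcap$, unary $\neg,\lrcorner$, constants $\top,\bot$) such that, writing $x\vee y:=\neg(\neg x\sqcap\neg y)$ and $x\wedge y:=\lrcorner(\lrcorner x\sqcup\lrcorner y)$, for all $x,y,z\in D$: $(x\sqcap x)\sqcap y=x\sqcap y$; $(x\sqcup x)\sqcup y=x\sqcup y$; $\sqcap$ and $\sqcup$ are commutative and associative; $\neg(x\sqcap x)=\neg x$; $\lrcorner(x\sqcup x)=\lrcorner x$; $x\sqcap(x\sqcup y)=x\sqcap x$; $x\sqcup(x\sqcap y)=x\sqcup x$; $x\sqcap(y\vee z)=(x\sqcap y)\vee(x\sqcap z)$; $x\sqcup(y\wedge z)=(x\sqcup y)\wedge(x\sqcup z)$; $x\sqcap(x\vee y)=x\sqcap x$; $x\sqcup(x\wedge y)=x\sqcup x$; $\neg\neg(x\sqcap y)=x\sqcap y$; $\lrcorner\lrcorner(x\sqcup y)=x\sqcup y$; $x\sqcap\neg x=\bot$; $x\sqcup\lrcorner x=\top$; $\neg\bot=\top\sqcap\top$; $\lrcorner\top=\bot\sqcup\bot$; $\neg\top=\bot$; $\lrcorner\bot=\top$; $(x\sqcap x)\sqcup(x\sqcap x)=(x\sqcup x)\sqcap(x\sqcup x)$. It is pure (a pdBa) if for every $x\in D$, $x\sqcap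 x=x$ or $x\sqcup x=x$. Put $D_\sqcap=\{x:x\sqcap x=x\}$, $D_\sqcup=\{x:x\sqcup x=x\}$, and $x\sqsubseteq y$ iff $x\sqcap y=x\sqcap x$ and $x\sqcup y=y\sqcup y$. The logic PDBL. The language has two disjoint countably infinite sets of variables, object variables $\mathbf{OV}$ ($p,q,\dots$) and property variables $\mathbf{PV}$ ($P,Q,\dots$), constants $\top,\bot$, binary connectives $\sqcap,\sqcup$ and unary connectives $\neg,\lrcorner$; formulae: $\top\mid\bot\mid p\mid P\mid\alpha\sqcup\beta\mid\alpha\sqcap\beta\mid\neg\alpha\mid\lrcorner\alpha$. Abbreviations: $\alpha\vee\beta:=\neg(\neg\alpha\sqcap\neg\beta)$, $\alpha\wedge\beta:=\lrcorner(\lrcorner\alpha\sqcup\lrcorner\beta)$. A sequent is a pair of formulae written $\alpha\vdash\beta$; $\alpha\dashv\vdash\beta$ abbreviates the two sequents $\alpha\vdash\beta$, $\beta\vdash\alpha$. An s-hypersequent is a finite sequence $\alpha_1\vdash\beta_1\mid\dots\mid\alpha_n\vdash\beta_n$ of sequents (its components); $B,C,D,E,F,G,H,X$ range over possibly empty s-hypersequents. Axioms (for all formulae $\alpha,\beta,\gamma$, $p\in\mathbf{OV}$, $P\in\mathbf{PV}$): $\alpha\vdash\alpha$; $\alpha\sqcap\beta\vdash\alpha$; $\alpha\sqcap\beta\vdash\beta$; $\alpha\vdash\alpha\sqcup\beta$; $\beta\vdash\alpha\sqcup\beta$; $\alpha\sqcap\beta\vdash(\alpha\sqcap\beta)\sqcap(\alpha\sqcap\beta)$;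 $(\alpha\sqcup\beta)\sqcup(\alpha\sqcup\beta)\vdash\alpha\sqcup\beta$; $\neg(\alpha\sqcap\alpha)\vdash\neg\alpha$; $\lrcorner\alpha\vdash\lrcorner(\alpha\sqcup\alpha)$; $\alpha\sqcap\neg\alpha\vdash\bot$; $\top\vdash\alpha\sqcup\lrcorner\alpha$; $\neg\neg(\alpha\sqcap\beta)\dashv\vdash\alpha\sqcap\beta$; $\lrcorner\lrcorner(\alpha\sqcup\beta)\dashv\vdash\alpha\sqcup\beta$; $\alpha\sqcap\alpha\vdash\alpha\sqcap(\alpha\sqcup\beta)$; $\alpha\sqcup(\alpha\sqcap\beta)\vdash\alpha\sqcup\alpha$; $\alpha\sqcap\alpha\vdash\alpha\sqcap(\alpha\vee\beta)$; $\alpha\sqcup(\alpha\wedge\beta)\vdash\alpha\sqcup\alpha$; $\alpha\sqcap(\beta\vee\gamma)\dashv\vdash(\alpha\sqcap\beta)\vee(\alpha\sqcap\gamma)$; $\alpha\sqcup(\beta\wedge\gamma)\dashv\vdash(\alpha\sqcup\beta)\wedge(\alpha\sqcup\gamma)$; $\bot\vdash\alpha$; $\alpha\vdash\top$; $\neg\top\vdash\bot$; $\top\vdash\lrcorner\bot$; $\neg\bot\dashv\vdash\top\sqcap\top$; $\lrcorner\top\dashv\vdash\bot\sqcup\bot$; $(\alpha\sqcup\alpha)\sqcap(\alpha\sqcup\alpha)\dashv\vdash(\alpha\sqcap\alpha)\sqcup(\alpha\sqcap\alpha)$; $p\sqcap p\dashv\vdash p$; $P\sqcup P\dashv\vdash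 P$; and (Sp) the s-hypersequent $\alpha\vdash\alpha\sqcap\alpha\mid\alpha\sqcup\alpha\vdash\alpha$. Rules: from $B\mid\alpha\vdash\beta\mid C$ infer each of $B\mid\alpha\sqcap\gamma\vdash\beta\sqcap\gamma\mid C$, $B\mid\gamma\sqcap\alpha\vdash\gamma\sqcap\beta\mid C$, $B\mid\alpha\sqcup\gamma\vdash\beta\sqcup\gamma\mid C$, $B\mid\gamma\sqcup\alpha\vdash\gamma\sqcup\beta\mid C$, $B\mid\neg\beta\vdash\neg\alpha\mid C$, $B\mid\lrcorner\beta\vdash\lrcorner\alpha\mid C$; from $B\mid\alpha\vdash\beta\mid C$ and $D\mid\beta\vdash\gamma\mid E$ infer $B\mid D\mid\alpha\vdash\gamma\mid C\mid E$; from $B\mid\alpha\sqcap\beta\vdash\alpha\sqcap\alpha\mid C$, $D\mid\alpha\sqcap\alpha\vdash\alpha\sqcap\beta\mid E$, $F\mid\alpha\sqcup\beta\vdash\beta\sqcup\beta\mid G$, $H\mid\beta\sqcup\beta\vdash\alpha\sqcup\beta\mid X$ infer $B\mid D\mid F\mid H\mid\alpha\vdash\beta\mid C\mid E\mid G\mid X$; external rules: from $B\mid D\mid D\mid C$ infer $B\mid D\mid C$; from $B\mid D\mid E\mid C$ infer $B\mid E\mid D\mid C$; from $B$ infer $B\mid C$. An s-hypersequent is provable if it is the last member of a finite sequence each member of which is an axiom or follows from earlier members by a rule. Algebraic semantics. A valuation on a pdBa $\mathbf{D}$ is a map $v$ on $\mathbf{OV}\cup\mathbf{PV}\cup\{\top,\bot\}$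 with $v(p)\in D_\sqcap$ for $p\in\mathbf{OV}$, $v(P)\in D_\sqcup$ for $P\in\mathbf{PV}$, $v(\top)=\top$, $v(\bot)=\bot$, extended to all formulae homomorphically ($v(\alpha\sqcap\beta)=v(\alpha)\sqcap v(\beta)$, etc.). $v$ satisfies $\alpha\vdash\beta$ iff $v(\alpha)\sqsubseteq v(\beta)$, and satisfies an s-hypersequent iff it satisfies one of its components. An s-hypersequent is true in $\mathbf{D}$ if every valuation on $\mathbf{D}$ satisfies it, and valid in the class of pdBas if true in every pdBa. -}

module Defs where

open import Level using (Level) renaming (suc to lsuc)
open import Data.Nat using (ℕ)
open import Data.List using (List; []; _∷_; _++_; [_])
open import Data.List.Relation.Unary.Any using (Any)
open import Data.Product using (_×_)
open import Data.Sum using (_⊎_)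
open import Relation.Binary.PropositionalEquality using (_≡_)

record DBA (ℓ : Level) : Set (lsuc ℓ) where
  infixl 7 _⊓_
  infixl 6 _⊔_
  field
    Carrier : Set ℓ
    _⊔_ _⊓_ : Carrier → Carrier → Carrier
    ¬_ ⌟_   : Carrier → Carrier
    ⊤ ⊥     : Carrier

  _∨_ : Carrier → Carrier → Carrier
  x ∨ y = ¬ ((¬ x) ⊓ (¬ y))

  _∧_ : Carrier → Carrier → Carrier
  x ∧ y = ⌟ ((⌟ x) ⊔ (⌟ y))

  field
    ⊓-idem-l   : ∀ x y → (x ⊓ x) ⊓ y ≡ x ⊓ y
    ⊔-idem-l   : ∀ x y → (x ⊔ x) ⊔ y ≡ x ⊔ y
    ⊓-comm     : ∀ x y → x ⊓ y ≡ y ⊓ x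
    ⊔-comm     : ∀ x y → x ⊔ y ≡ y ⊔ x
    ⊓-assoc    : ∀ x y z → (x ⊓ y) ⊓ z ≡ x ⊓ (y ⊓ z)
    ⊔-assoc    : ∀ x y z → (x ⊔ y) ⊔ z ≡ x ⊔ (y ⊔ z)
    ¬-⊓-idem   : ∀ x → ¬ (x ⊓ x) ≡ ¬ x
    ⌟-⊔-idem   : ∀ x → ⌟ (x ⊔ x) ≡ ⌟ x
    ⊓-abs-⊔    : ∀ x y → x ⊓ (x ⊔ y) ≡ x ⊓ x
    ⊔-abs-⊓    : ∀ x y → x ⊔ (x ⊓ y) ≡ x ⊔ x
    ⊓-distrib-∨ : ∀ x y z → x ⊓ (y ∨ z) ≡ (x ⊓ y) ∨ (x ⊓ z)
    ⊔-distrib-∧ : ∀ x y z → x ⊔ (y ∧ z) ≡ (x ⊔ y) ∧ (x ⊔ z)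
    ⊓-abs-∨    : ∀ x y → x ⊓ (x ∨ y) ≡ x ⊓ x
    ⊔-abs-∧    : ∀ x y → x ⊔ (x ∧ y) ≡ x ⊔ x
    ¬¬-⊓       : ∀ x y → ¬ (¬ (x ⊓ y)) ≡ x ⊓ y
    ⌟⌟-⊔       : ∀ x y → ⌟ (⌟ (x ⊔ y)) ≡ x ⊔ y
    ⊓-¬        : ∀ x → x ⊓ (¬ x) ≡ ⊥
    ⊔-⌟        : ∀ x → x ⊔ (⌟ x) ≡ ⊤
    ¬⊥         : ¬ ⊥ ≡ ⊤ ⊓ ⊤
    ⌟⊤         : ⌟ ⊤ ≡ ⊥ ⊔ ⊥
    ¬⊤         : ¬ ⊤ ≡ ⊥
    ⌟⊥         : ⌟ ⊥ ≡ ⊤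
    mixed      : ∀ x → (x ⊓ x) ⊔ (x ⊓ x) ≡ (x ⊔ x) ⊓ (x ⊔ x)

  _⊑_ : Carrier → Carrier → Set ℓ
  x ⊑ y = (x ⊓ y ≡ x ⊓ x) × (x ⊔ y ≡ y ⊔ y)

  IsPure : Set ℓ
  IsPure = ∀ x → (x ⊓ x ≡ x) ⊎ (x ⊔ x ≡ x)

record PDBA (ℓ : Level) : Set (lsuc ℓ) where
  field
    dba  : DBA ℓ
    pure : DBA.IsPure dba
  open DBA dba public

-- Syntax of PDBL
-- Object variables: ov n, property variables: pv n (n : ℕ), two disjoint
-- countably infinite sets.

infixl 7 _⊓ᶠ_
infixl 6 _⊔ᶠ_
data Formula : Set where
  ⊤ᶠ ⊥ᶠ   : Formula
  ov      : ℕ → Formula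
  pv      : ℕ → Formula
  _⊔ᶠ_ _⊓ᶠ_ : Formula → Formula → Formula
  ¬ᶠ_ ⌟ᶠ_  : Formula → Formula

_∨ᶠ_ : Formula → Formula → Formula
a ∨ᶠ b = ¬ᶠ ((¬ᶠ a) ⊓ᶠ (¬ᶠ b))

_∧ᶠ_ : Formula → Formula → Formula
a ∧ᶠ b = ⌟ᶠ ((⌟ᶠ a) ⊔ᶠ (⌟ᶠ b))

infix 4 _⊢_
record Sequent : Set where
  constructor _⊢_
  field
    lhs rhs : Formula

HSeq : Set
HSeq = List Sequent

data AxiomSeq : Sequent → Set where
  refl-ax   : ∀ a → AxiomSeq (a ⊢ a)
  ⊓-l       : ∀ a b → AxiomSeq (a ⊓ᶠ b ⊢ a)
  ⊓-r       : ∀ a b → AxiomSeq (a ⊓ᶠ b ⊢ b)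
  ⊔-l       : ∀ a b → AxiomSeq (a ⊢ a ⊔ᶠ b)
  ⊔-r       : ∀ a b → AxiomSeq (b ⊢ a ⊔ᶠ b)
  ⊓-dup     : ∀ a b → AxiomSeq (a ⊓ᶠ b ⊢ (a ⊓ᶠ b) ⊓ᶠ (a ⊓ᶠ b))
  ⊔-dup     : ∀ a b → AxiomSeq ((a ⊔ᶠ b) ⊔ᶠ (a ⊔ᶠ b) ⊢ a ⊔ᶠ b)
  ¬-idem    : ∀ a → AxiomSeq (¬ᶠ (a ⊓ᶠ a) ⊢ ¬ᶠ a)
  ⌟-idem    : ∀ a → AxiomSeq (⌟ᶠ a ⊢ ⌟ᶠ (a ⊔ᶠ a))
  ⊓¬        : ∀ a → AxiomSeq (a ⊓ᶠ (¬ᶠ a) ⊢ ⊥ᶠ)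
  ⊔⌟        : ∀ a → AxiomSeq (⊤ᶠ ⊢ a ⊔ᶠ (⌟ᶠ a))
  ¬¬-1      : ∀ a b → AxiomSeq (¬ᶠ (¬ᶠ (a ⊓ᶠ b)) ⊢ a ⊓ᶠ b)
  ¬¬-2      : ∀ a b → AxiomSeq (a ⊓ᶠ b ⊢ ¬ᶠ (¬ᶠ (a ⊓ᶠ b)))
  ⌟⌟-1      : ∀ a b → AxiomSeq (⌟ᶠ (⌟ᶠ (a ⊔ᶠ b)) ⊢ a ⊔ᶠ b)
  ⌟⌟-2      : ∀ a b → AxiomSeq (a ⊔ᶠ b ⊢ ⌟ᶠ (⌟ᶠ (a ⊔ᶠ b)))
  abs-⊓⊔    : ∀ a b → AxiomSeq (a ⊓ᶠ a ⊢ a ⊓ᶠ (a ⊔ᶠ b))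
  abs-⊔⊓    : ∀ a b → AxiomSeq (a ⊔ᶠ (a ⊓ᶠ b) ⊢ a ⊔ᶠ a)
  abs-⊓∨    : ∀ a b → AxiomSeq (a ⊓ᶠ a ⊢ a ⊓ᶠ (a ∨ᶠ b))
  abs-⊔∧    : ∀ a b → AxiomSeq (a ⊔ᶠ (a ∧ᶠ b) ⊢ a ⊔ᶠ a)
  dist-∨-1  : ∀ a b c → AxiomSeq (a ⊓ᶠ (b ∨ᶠ c) ⊢ (a ⊓ᶠ b) ∨ᶠ (a ⊓ᶠ c))
  dist-∨-2  : ∀ a b c → AxiomSeq ((a ⊓ᶠ b) ∨ᶠ (a ⊓ᶠ c) ⊢ a ⊓ᶠ (b ∨ᶠ c))
  dist-∧-1  : ∀ a b c → AxiomSeq (a ⊔ᶠ (b ∧ᶠ c) ⊢ (a ⊔ᶠ b) ∧ᶠ (a ⊔ᶠ c))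
  dist-∧-2  : ∀ a b c → AxiomSeq ((a ⊔ᶠ b) ∧ᶠ (a ⊔ᶠ c) ⊢ a ⊔ᶠ (b ∧ᶠ c))
  ⊥-ax      : ∀ a → AxiomSeq (⊥ᶠ ⊢ a)
  ⊤-ax      : ∀ a → AxiomSeq (a ⊢ ⊤ᶠ)
  ¬⊤-ax     : AxiomSeq (¬ᶠ ⊤ᶠ ⊢ ⊥ᶠ)
  ⌟⊥-ax     : AxiomSeq (⊤ᶠ ⊢ ⌟ᶠ ⊥ᶠ)
  ¬⊥-1      : AxiomSeq (¬ᶠ ⊥ᶠ ⊢ ⊤ᶠ ⊓ᶠ ⊤ᶠ)
  ¬⊥-2      : AxiomSeq (⊤ᶠ ⊓ᶠ ⊤ᶠ ⊢ ¬ᶠ ⊥ᶠ)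
  ⌟⊤-1      : AxiomSeq (⌟ᶠ ⊤ᶠ ⊢ ⊥ᶠ ⊔ᶠ ⊥ᶠ)
  ⌟⊤-2      : AxiomSeq (⊥ᶠ ⊔ᶠ ⊥ᶠ ⊢ ⌟ᶠ ⊤ᶠ)
  mixed-1   : ∀ a → AxiomSeq ((a ⊔ᶠ a) ⊓ᶠ (a ⊔ᶠ a) ⊢ (a ⊓ᶠ a) ⊔ᶠ (a ⊓ᶠ a))
  mixed-2   : ∀ a → AxiomSeq ((a ⊓ᶠ a) ⊔ᶠ (a ⊓ᶠ a) ⊢ (a ⊔ᶠ a) ⊓ᶠ (a ⊔ᶠ a))
  ov-1      : ∀ n → AxiomSeq (ov n ⊓ᶠ ov n ⊢ ov n)
  ov-2      : ∀ n → AxiomSeq (ov n ⊢ ov n ⊓ᶠ ov n)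
  pv-1      : ∀ n → AxiomSeq (pv n ⊔ᶠ pv n ⊢ pv n)
  pv-2      : ∀ n → AxiomSeq (pv n ⊢ pv n ⊔ᶠ pv n)

data Provable : HSeq → Set where
  axiom : ∀ {s} → AxiomSeq s → Provable [ s ]
  sp    : ∀ a → Provable ((a ⊢ a ⊓ᶠ a) ∷ (a ⊔ᶠ a ⊢ a) ∷ [])
  mon-⊓ʳ : ∀ {B C a b} c → Provable (B ++ (a ⊢ b) ∷ C)
         → Provable (B ++ (a ⊓ᶠ c ⊢ b ⊓ᶠ c) ∷ C)
  mon-⊓ˡ : ∀ {B C a b} c → Provable (B ++ (a ⊢ b) ∷ C)
         → Provable (B ++ (c ⊓ᶠ a ⊢ c ⊓ᶠ b) ∷ C)
  mon-⊔ʳ : ∀ {B C a b} c → Provable (B ++ (a ⊢ b) ∷ C)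
         → Provable (B ++ (a ⊔ᶠ c ⊢ b ⊔ᶠ c) ∷ C)
  mon-⊔ˡ : ∀ {B C a b} c → Provable (B ++ (a ⊢ b) ∷ C)
         → Provable (B ++ (c ⊔ᶠ a ⊢ c ⊔ᶠ b) ∷ C)
  anti-¬ : ∀ {B C a b} → Provable (B ++ (a ⊢ b) ∷ C)
         → Provable (B ++ (¬ᶠ b ⊢ ¬ᶠ a) ∷ C)
  anti-⌟ : ∀ {B C a b} → Provable (B ++ (a ⊢ b) ∷ C)
         → Provable (B ++ (⌟ᶠ b ⊢ ⌟ᶠ a) ∷ C)
  cut    : ∀ {B C D E a b c}
         → Provable (B ++ (a ⊢ b) ∷ C)
         → Provable (D ++ (b ⊢ c) ∷ E)
         → Provable (B ++ D ++ (a ⊢ c) ∷ C ++ E)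
  ⊑-intro : ∀ {B C D E F G H X a b}
         → Provable (B ++ (a ⊓ᶠ b ⊢ a ⊓ᶠ a) ∷ C)
         → Provable (D ++ (a ⊓ᶠ a ⊢ a ⊓ᶠ b) ∷ E)
         → Provable (F ++ (a ⊔ᶠ b ⊢ b ⊔ᶠ b) ∷ G)
         → Provable (H ++ (b ⊔ᶠ b ⊢ a ⊔ᶠ b) ∷ X)
         → Provable (B ++ D ++ F ++ H ++ (a ⊢ b) ∷ C ++ E ++ G ++ X)
  ext-contr : ∀ {B C D : HSeq} → Provable (B ++ D ++ D ++ C) → Provable (B ++ D ++ C)
  ext-exch  : ∀ {B C D E : HSeq} → Provable (B ++ D ++ E ++ C) → Provable (B ++ E ++ D ++ C)
  ext-weak  : ∀ {B C : HSeq} → Provable B → Provable (B ++ C)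

module _ {ℓ : Level} (𝔻 : PDBA ℓ) where
  open PDBA 𝔻

  record Valuation : Set ℓ where
    field
      vo    : ℕ → Carrier
      vo-⊓  : ∀ n → vo n ⊓ vo n ≡ vo n
      vp    : ℕ → Carrier
      vp-⊔  : ∀ n → vp n ⊔ vp n ≡ vp n

  eval : Valuation → Formula → Carrier
  eval v ⊤ᶠ = ⊤
  eval v ⊥ᶠ = ⊥
  eval v (ov n) = Valuation.vo v n
  eval v (pv n) = Valuation.vp v n
  eval v (a ⊔ᶠ b) = eval v a ⊔ eval v b
  eval v (a ⊓ᶠ b) = eval v a ⊓ eval v b
  eval v (¬ᶠ a) = ¬ eval v a
  eval v (⌟ᶠ a) = ⌟ eval v a

  SatSeq : Valuation → Sequent → Set ℓ
  SatSeq v (a ⊢ b) = eval v a ⊑ eval v b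

  SatH : Valuation → HSeq → Set ℓ
  SatH v h = Any (SatSeq v) h

  TrueIn : HSeq → Set ℓ
  TrueIn h = ∀ (v : Valuation) → SatH v h

Valid : ∀ ℓ → HSeq → Set (lsuc ℓ)
Valid ℓ h = ∀ (𝔻 : PDBA ℓ) → TrueIn 𝔻 h

{-# OPTIONS --safe #-}
-- The quasi-order ⊑ of a dBa is reflexive
-- and transitive, monotone for ⊓ and ⊔, antitone for ¬ and ⌟, and has ⊥ and ⊤
-- as least and greatest elements; this validates the axioms and the logical
-- rules. The ⊑-introduction rule is sound because ⊑ is antisymmetric on D_⊓
-- and on D_⊔, and (Sp) is exactly purity. The dBa axioms are invariant under
-- exchanging ⊓ with ⊔, ¬ with ⌟ and ⊤ with ⊥, which reverses ⊑, so only the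
-- meet half of these facts needs a proof.
module Submission where

open import Defs
open import Level using (Level)
open import Function using (_∘_; id)
open import Relation.Unary using (Pred)
open import Relation.Binary.PropositionalEquality
open import Data.Product using (_,_)
open import Data.Sum using ([_,_]′)
open import Data.List using (List; []; _∷_; _++_)
open import Data.List.Relation.Unary.Any using (Any; here; there; toSum)
open import Data.List.Relation.Unary.Any.Properties using (++⁺ˡ; ++⁺ʳ; ++⁻)
open import Data.List.Relation.Binary.Permutation.Propositional
  using (_↭_; ↭-sym; ↭-trans)
import Data.List.Relation.Binary.Permutation.Propositional.Properties as ↭
open import Algebra.Bundles using (CommutativeSemigroup)
import Algebra.Properties.CommutativeSemigroup as CommutativeSemigroupProperties

dual : ∀ {ℓ} → DBA ℓ → DBA ℓ
dual 𝔻 = record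
  { Carrier     = Carrier
  ; _⊔_         = _⊓_
  ; _⊓_         = _⊔_
  ; ¬_          = ⌟_
  ; ⌟_          = ¬_
  ; ⊤           = ⊥
  ; ⊥           = ⊤
  ; ⊓-idem-l    = ⊔-idem-l
  ; ⊔-idem-l    = ⊓-idem-l
  ; ⊓-comm      = ⊔-comm
  ; ⊔-comm      = ⊓-comm
  ; ⊓-assoc     = ⊔-assoc
  ; ⊔-assoc     = ⊓-assoc
  ; ¬-⊓-idem    = ⌟-⊔-idem
  ; ⌟-⊔-idem    = ¬-⊓-idem
  ; ⊓-abs-⊔     = ⊔-abs-⊓
  ; ⊔-abs-⊓     = ⊓-abs-⊔
  ; ⊓-distrib-∨ = ⊔-distrib-∧
  ; ⊔-distrib-∧ = ⊓-distrib-∨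
  ; ⊓-abs-∨     = ⊔-abs-∧
  ; ⊔-abs-∧     = ⊓-abs-∨
  ; ¬¬-⊓        = ⌟⌟-⊔
  ; ⌟⌟-⊔        = ¬¬-⊓
  ; ⊓-¬         = ⊔-⌟
  ; ⊔-⌟         = ⊓-¬
  ; ¬⊥          = ⌟⊤
  ; ⌟⊤          = ¬⊥
  ; ¬⊤          = ⌟⊥
  ; ⌟⊥          = ¬⊤
  ; mixed       = sym ∘ mixed
  }
  where open DBA 𝔻

module ⊓-Properties {ℓ} (𝔻 : DBA ℓ) where
  open DBA 𝔻
  open ≡-Reasoning

  ⊓-commutativeSemigroup : CommutativeSemigroup ℓ ℓ
  ⊓-commutativeSemigroup = record
    { Carrier = Carrier
    ; _≈_     = _≡_
    ; _∙_     = _⊓_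
    ; isCommutativeSemigroup = record
      { isSemigroup = record
        { isMagma = record { isEquivalence = isEquivalence ; ∙-cong = cong₂ _⊓_ }
        ; assoc   = ⊓-assoc
        }
      ; comm        = ⊓-comm
      }
    }

  open CommutativeSemigroupProperties ⊓-commutativeSemigroup
    using () renaming (interchange to ⊓-interchange; x∙yz≈y∙xz to x⊓yz≡y⊓xz)

  x⊓yy≡x⊓y : ∀ x y → x ⊓ (y ⊓ y) ≡ x ⊓ y
  x⊓yy≡x⊓y x y = trans (⊓-comm x _) (trans (⊓-idem-l y x) (⊓-comm y x))

  x⊓xy≡x⊓y : ∀ x y → x ⊓ (x ⊓ y) ≡ x ⊓ y
  x⊓xy≡x⊓y x y = trans (sym (⊓-assoc x x y)) (⊓-idem-l x y)

  y⊓xy≡x⊓y : ∀ x y → y ⊓ (x ⊓ y) ≡ x ⊓ y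
  y⊓xy≡x⊓y x y = trans (x⊓yz≡y⊓xz y x y) (x⊓yy≡x⊓y x y)

  xy⊓xy≡x⊓y : ∀ x y → (x ⊓ y) ⊓ (x ⊓ y) ≡ x ⊓ y
  xy⊓xy≡x⊓y x y = begin
    (x ⊓ y) ⊓ (x ⊓ y) ≡⟨ ⊓-interchange x y x y ⟩
    (x ⊓ x) ⊓ (y ⊓ y) ≡⟨ ⊓-idem-l x (y ⊓ y) ⟩
    x ⊓ (y ⊓ y)       ≡⟨ x⊓yy≡x⊓y x y ⟩
    x ⊓ y             ∎

  ¬¬x≡x⊓x : ∀ x → ¬ ¬ x ≡ x ⊓ x
  ¬¬x≡x⊓x x = trans (cong ¬_ (sym (¬-⊓-idem x))) (¬¬-⊓ x x)

  x∨x≡x⊓x : ∀ x → x ∨ x ≡ x ⊓ x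
  x∨x≡x⊓x x = begin
    ¬ (¬ x ⊓ ¬ x)                 ≡⟨ cong (λ t → ¬ (t ⊓ t)) (sym (¬-⊓-idem x)) ⟩
    (x ⊓ x) ∨ (x ⊓ x)             ≡⟨ sym (⊓-distrib-∨ x x x) ⟩
    x ⊓ (x ∨ x)                   ≡⟨ ⊓-abs-∨ x x ⟩
    x ⊓ x                         ∎

  ¬x⊓¬x≡¬x : ∀ x → ¬ x ⊓ ¬ x ≡ ¬ x
  ¬x⊓¬x≡¬x x = begin
    ¬ x ⊓ ¬ x         ≡⟨ sym (¬¬-⊓ (¬ x) (¬ x)) ⟩
    ¬ (x ∨ x)         ≡⟨ cong ¬_ (x∨x≡x⊓x x) ⟩
    ¬ (x ⊓ x)         ≡⟨ ¬-⊓-idem x ⟩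
    ¬ x               ∎

  ⊥⊓x≡⊥ : ∀ x → ⊥ ⊓ x ≡ ⊥
  ⊥⊓x≡⊥ x = begin
    ⊥ ⊓ x             ≡⟨ cong (_⊓ x) (sym (⊓-¬ x)) ⟩
    (x ⊓ ¬ x) ⊓ x     ≡⟨ ⊓-comm _ x ⟩
    x ⊓ (x ⊓ ¬ x)     ≡⟨ x⊓xy≡x⊓y x (¬ x) ⟩
    x ⊓ ¬ x           ≡⟨ ⊓-¬ x ⟩
    ⊥                 ∎

  x⊓y≡x⇒x⊔y≡y⊔y : ∀ {x y} → x ⊓ y ≡ x → x ⊔ y ≡ y ⊔ y
  x⊓y≡x⇒x⊔y≡y⊔y {x} {y} x⊓y≡x = begin
    x ⊔ y             ≡⟨ cong (_⊔ y) (sym x⊓y≡x) ⟩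
    (x ⊓ y) ⊔ y       ≡⟨ ⊔-comm _ y ⟩
    y ⊔ (x ⊓ y)       ≡⟨ cong (y ⊔_) (⊓-comm x y) ⟩
    y ⊔ (y ⊓ x)       ≡⟨ ⊔-abs-⊓ y x ⟩
    y ⊔ y             ∎

  ⊑-reflexive : ∀ {x y} → x ≡ y → x ⊑ y
  ⊑-reflexive refl = refl , refl

  ⊑-trans-⊓ : ∀ {x y z} → x ⊑ y → y ⊑ z → x ⊓ z ≡ x ⊓ x
  ⊑-trans-⊓ {x} {y} {z} (x⊓y , _) (y⊓z , _) = begin
    x ⊓ z             ≡⟨ ⊓-idem-l x z ⟨
    (x ⊓ x) ⊓ z       ≡⟨ cong (_⊓ z) x⊓y ⟨
    (x ⊓ y) ⊓ z       ≡⟨ ⊓-assoc x y z ⟩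
    x ⊓ (y ⊓ z)       ≡⟨ cong (x ⊓_) y⊓z ⟩
    x ⊓ (y ⊓ y)       ≡⟨ x⊓yy≡x⊓y x y ⟩
    x ⊓ y             ≡⟨ x⊓y ⟩
    x ⊓ x             ∎

  ⊓-idem⇒⊑ : ∀ {x y} → x ⊓ x ≡ x → x ⊓ y ≡ x → x ⊑ y
  ⊓-idem⇒⊑ x⊓x≡x x⊓y≡x = trans x⊓y≡x (sym x⊓x≡x) , x⊓y≡x⇒x⊔y≡y⊔y x⊓y≡x

  x⊓y⊑x : ∀ x y → (x ⊓ y) ⊑ x
  x⊓y⊑x x y = ⊓-idem⇒⊑ (xy⊓xy≡x⊓y x y) (trans (⊓-comm _ x) (x⊓xy≡x⊓y x y))

  x⊓y⊑y : ∀ x y → (x ⊓ y) ⊑ y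
  x⊓y⊑y x y = ⊓-idem⇒⊑ (xy⊓xy≡x⊓y x y) (trans (⊓-comm _ y) (y⊓xy≡x⊓y x y))

  ⊥-minimum : ∀ x → ⊥ ⊑ x
  ⊥-minimum x = ⊓-idem⇒⊑ (⊥⊓x≡⊥ ⊥) (⊥⊓x≡⊥ x)

  ⊓-monoˡ-⊑ : ∀ z {x y} → x ⊑ y → (x ⊓ z) ⊑ (y ⊓ z)
  ⊓-monoˡ-⊑ z {x} {y} (x⊓y , _) = ⊓-idem⇒⊑ (xy⊓xy≡x⊓y x z) (begin
    (x ⊓ z) ⊓ (y ⊓ z) ≡⟨ ⊓-interchange x z y z ⟩
    (x ⊓ y) ⊓ (z ⊓ z) ≡⟨ cong (_⊓ (z ⊓ z)) x⊓y ⟩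
    (x ⊓ x) ⊓ (z ⊓ z) ≡⟨ ⊓-interchange x z x z ⟨
    (x ⊓ z) ⊓ (x ⊓ z) ≡⟨ xy⊓xy≡x⊓y x z ⟩
    x ⊓ z             ∎)

  ⊓-monoʳ-⊑ : ∀ z {x y} → x ⊑ y → (z ⊓ x) ⊑ (z ⊓ y)
  ⊓-monoʳ-⊑ z {x} {y} x⊑y =
    subst₂ _⊑_ (⊓-comm x z) (⊓-comm y z) (⊓-monoˡ-⊑ z x⊑y)

  ¬-antitone : ∀ {x y} → x ⊑ y → (¬ y) ⊑ (¬ x)
  ¬-antitone {x} {y} (x⊓y , _) = ⊓-idem⇒⊑ (¬x⊓¬x≡¬x y) (begin
    ¬ y ⊓ ¬ x         ≡⟨ cong (¬ y ⊓_) (sym ¬y∨¬x≡¬x) ⟩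
    ¬ y ⊓ ((¬ y) ∨ (¬ x)) ≡⟨ ⊓-abs-∨ (¬ y) (¬ x) ⟩
    ¬ y ⊓ ¬ y         ≡⟨ ¬x⊓¬x≡¬x y ⟩
    ¬ y               ∎)
    where
      ¬y∨¬x≡¬x : (¬ y) ∨ (¬ x) ≡ ¬ x
      ¬y∨¬x≡¬x = begin
        ¬ (¬ ¬ y ⊓ ¬ ¬ x)     ≡⟨ cong₂ (λ s t → ¬ (s ⊓ t)) (¬¬x≡x⊓x y) (¬¬x≡x⊓x x) ⟩
        ¬ ((y ⊓ y) ⊓ (x ⊓ x)) ≡⟨ cong ¬_ (⊓-comm (y ⊓ y) (x ⊓ x)) ⟩
        ¬ ((x ⊓ x) ⊓ (y ⊓ y)) ≡⟨ cong ¬_ (⊓-idem-l x (y ⊓ y)) ⟩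
        ¬ (x ⊓ (y ⊓ y))       ≡⟨ cong ¬_ (x⊓yy≡x⊓y x y) ⟩
        ¬ (x ⊓ y)             ≡⟨ cong ¬_ x⊓y ⟩
        ¬ (x ⊓ x)             ≡⟨ ¬-⊓-idem x ⟩
        ¬ x                   ∎

  ⊑-antisym-D⊓ : ∀ {x y} → x ⊓ x ≡ x → y ⊓ y ≡ y → x ⊑ y → y ⊑ x → x ≡ y
  ⊑-antisym-D⊓ {x} {y} x∈D⊓ y∈D⊓ (x⊓y , _) (y⊓x , _) = begin
    x                 ≡⟨ x∈D⊓ ⟨
    x ⊓ x             ≡⟨ x⊓y ⟨
    x ⊓ y             ≡⟨ ⊓-comm x y ⟩
    y ⊓ x             ≡⟨ y⊓x ⟩
    y ⊓ y             ≡⟨ y∈D⊓ ⟩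
    y                 ∎

module ⊑-Properties {ℓ} (𝔻 : DBA ℓ) where
  open DBA 𝔻
  open ⊓-Properties 𝔻 public
  private
    module 𝔻ᵈ = DBA (dual 𝔻)
    module ᵈ = ⊓-Properties (dual 𝔻)

  ⊑⇒⊒ᵈ : ∀ {x y} → x ⊑ y → y 𝔻ᵈ.⊑ x
  ⊑⇒⊒ᵈ {x} {y} (x⊓y , x⊔y) = trans (⊔-comm y x) x⊔y , trans (⊓-comm y x) x⊓y

  ⊑ᵈ⇒⊒ : ∀ {x y} → x 𝔻ᵈ.⊑ y → y ⊑ x
  ⊑ᵈ⇒⊒ {x} {y} (x⊔y , x⊓y) = trans (⊓-comm y x) x⊓y , trans (⊔-comm y x) x⊔y

  xy⊔xy≡x⊔y : ∀ x y → (x ⊔ y) ⊔ (x ⊔ y) ≡ x ⊔ y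
  xy⊔xy≡x⊔y = ᵈ.xy⊓xy≡x⊓y

  ⊑-trans : ∀ {x y z} → x ⊑ y → y ⊑ z → x ⊑ z
  ⊑-trans {x} {z = z} x⊑y y⊑z =
    ⊑-trans-⊓ x⊑y y⊑z ,
    trans (⊔-comm x z) (ᵈ.⊑-trans-⊓ (⊑⇒⊒ᵈ y⊑z) (⊑⇒⊒ᵈ x⊑y))

  x⊑x⊔y : ∀ x y → x ⊑ (x ⊔ y)
  x⊑x⊔y x y = ⊑ᵈ⇒⊒ (ᵈ.x⊓y⊑x x y)

  y⊑x⊔y : ∀ x y → y ⊑ (x ⊔ y)
  y⊑x⊔y x y = ⊑ᵈ⇒⊒ (ᵈ.x⊓y⊑y x y)

  ⊤-maximum : ∀ x → x ⊑ ⊤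
  ⊤-maximum x = ⊑ᵈ⇒⊒ (ᵈ.⊥-minimum x)

  ⊔-monoˡ-⊑ : ∀ z {x y} → x ⊑ y → (x ⊔ z) ⊑ (y ⊔ z)
  ⊔-monoˡ-⊑ z = ⊑ᵈ⇒⊒ ∘ ᵈ.⊓-monoˡ-⊑ z ∘ ⊑⇒⊒ᵈ

  ⊔-monoʳ-⊑ : ∀ z {x y} → x ⊑ y → (z ⊔ x) ⊑ (z ⊔ y)
  ⊔-monoʳ-⊑ z = ⊑ᵈ⇒⊒ ∘ ᵈ.⊓-monoʳ-⊑ z ∘ ⊑⇒⊒ᵈ

  ⌟-antitone : ∀ {x y} → x ⊑ y → (⌟ y) ⊑ (⌟ x)
  ⌟-antitone = ⊑ᵈ⇒⊒ ∘ ᵈ.¬-antitone ∘ ⊑⇒⊒ᵈ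

  ⊑-antisym-D⊔ : ∀ {x y} → x ⊔ x ≡ x → y ⊔ y ≡ y → x ⊑ y → y ⊑ x → x ≡ y
  ⊑-antisym-D⊔ x∈D⊔ y∈D⊔ x⊑y y⊑x = ᵈ.⊑-antisym-D⊓ x∈D⊔ y∈D⊔ (⊑⇒⊒ᵈ y⊑x) (⊑⇒⊒ᵈ x⊑y)

  ⊑-from-components : ∀ {x y} → (x ⊓ y) ⊑ (x ⊓ x) → (x ⊓ x) ⊑ (x ⊓ y)
                    → (x ⊔ y) ⊑ (y ⊔ y) → (y ⊔ y) ⊑ (x ⊔ y) → x ⊑ y
  ⊑-from-components {x} {y} p₁ p₂ p₃ p₄ =
    ⊑-antisym-D⊓ (xy⊓xy≡x⊓y x y) (xy⊓xy≡x⊓y x x) p₁ p₂ ,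
    ⊑-antisym-D⊔ (xy⊔xy≡x⊔y x y) (xy⊔xy≡x⊔y y y) p₃ p₄

module _ {a p} {A : Set a} {P : Pred A p} where

  ++-monoʳ : ∀ B {xs ys : List A}
           → (Any P xs → Any P ys) → Any P (B ++ xs) → Any P (B ++ ys)
  ++-monoʳ B f = [ ++⁺ˡ , ++⁺ʳ B ∘ f ]′ ∘ ++⁻ B

  ++-∷-elim : ∀ B {x C r} {R : Set r}
            → (Any P B → R) → (P x → R) → (Any P C → R) → Any P (B ++ x ∷ C) → R
  ++-∷-elim B inB inX inC = [ inB , [ inX , inC ]′ ∘ toSum ]′ ∘ ++⁻ B

  replace : ∀ B {x y C} → (P x → P y) → Any P (B ++ x ∷ C) → Any P (B ++ y ∷ C)
  replace B f = ++-monoʳ B ([ here ∘ f , there ]′ ∘ toSum)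

  contract : ∀ B D {C} → Any P (B ++ D ++ D ++ C) → Any P (B ++ D ++ C)
  contract B D = ++-monoʳ B ([ ++⁺ˡ , id ]′ ∘ ++⁻ D)

  exchange : ∀ B D E {C} → Any P (B ++ D ++ E ++ C) → Any P (B ++ E ++ D ++ C)
  exchange B D E {C} = ++-monoʳ B (↭.Any-resp-↭ D++E++C↭E++D++C)
    where
      D++E++C↭E++D++C : D ++ E ++ C ↭ E ++ D ++ C
      D++E++C↭E++D++C =
        ↭-trans (↭-sym (↭.++-assoc D E C))
          (↭-trans (↭.++⁺ʳ C (↭.++-comm D E)) (↭.++-assoc E D C))

  -- A witness in a side context of a premise reappears in the conclusion; if
  -- every premise is witnessed by its principal element, so is the conclusion.
  merge : ∀ B D {x y z C E} → (P x → P y → P z)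
        → Any P (B ++ x ∷ C) → Any P (D ++ y ∷ E) → Any P (B ++ D ++ z ∷ C ++ E)
  merge B D {C = C} f p q =
    ++-∷-elim B ++⁺ˡ (λ px →
    ++-∷-elim D (++⁺ʳ B ∘ ++⁺ˡ) (λ py → inTail (here (f px py)))
      (inTail ∘ there ∘ ++⁺ʳ C) q)
      (inTail ∘ there ∘ ++⁺ˡ) p
    where
      inTail : ∀ {ys} → Any P ys → Any P (B ++ D ++ ys)
      inTail = ++⁺ʳ B ∘ ++⁺ʳ D

  merge₄ : ∀ B D F H {x₁ x₂ x₃ x₄ y C E G X}
         → (P x₁ → P x₂ → P x₃ → P x₄ → P y)
         → Any P (B ++ x₁ ∷ C) → Any P (D ++ x₂ ∷ E)
         → Any P (F ++ x₃ ∷ G) → Any P (H ++ x₄ ∷ X)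
         → Any P (B ++ D ++ F ++ H ++ y ∷ C ++ E ++ G ++ X)
  merge₄ B D F H {C = C} {E} {G} f p₁ p₂ p₃ p₄ =
    ++-∷-elim B ++⁺ˡ (λ s₁ →
    ++-∷-elim D (++⁺ʳ B ∘ ++⁺ˡ) (λ s₂ →
    ++-∷-elim F (++⁺ʳ B ∘ ++⁺ʳ D ∘ ++⁺ˡ) (λ s₃ →
    ++-∷-elim H (++⁺ʳ B ∘ ++⁺ʳ D ∘ ++⁺ʳ F ∘ ++⁺ˡ) (λ s₄ →
      inTail (here (f s₁ s₂ s₃ s₄)))
      (inTail ∘ there ∘ ++⁺ʳ C ∘ ++⁺ʳ E ∘ ++⁺ʳ G) p₄)
      (inTail ∘ there ∘ ++⁺ʳ C ∘ ++⁺ʳ E ∘ ++⁺ˡ) p₃)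
      (inTail ∘ there ∘ ++⁺ʳ C ∘ ++⁺ˡ) p₂)
      (inTail ∘ there ∘ ++⁺ˡ) p₁
    where
      inTail : ∀ {ys} → Any P ys → Any P (B ++ D ++ F ++ H ++ ys)
      inTail = ++⁺ʳ B ∘ ++⁺ʳ D ∘ ++⁺ʳ F ∘ ++⁺ʳ H

module Soundness {ℓ} (𝔻 : PDBA ℓ) (v : Valuation 𝔻) where
  open PDBA 𝔻
  open ⊑-Properties dba

  ⟦_⟧ : Formula → Carrier
  ⟦_⟧ = eval 𝔻 v

  axiom-sound : ∀ {s} → AxiomSeq s → SatSeq 𝔻 v s
  axiom-sound (refl-ax a)      = ⊑-reflexive refl
  axiom-sound (⊓-l a b)        = x⊓y⊑x ⟦ a ⟧ ⟦ b ⟧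
  axiom-sound (⊓-r a b)        = x⊓y⊑y ⟦ a ⟧ ⟦ b ⟧
  axiom-sound (⊔-l a b)        = x⊑x⊔y ⟦ a ⟧ ⟦ b ⟧
  axiom-sound (⊔-r a b)        = y⊑x⊔y ⟦ a ⟧ ⟦ b ⟧
  axiom-sound (⊓-dup a b)      = ⊑-reflexive (sym (xy⊓xy≡x⊓y ⟦ a ⟧ ⟦ b ⟧))
  axiom-sound (⊔-dup a b)      = ⊑-reflexive (xy⊔xy≡x⊔y ⟦ a ⟧ ⟦ b ⟧)
  axiom-sound (¬-idem a)       = ⊑-reflexive (¬-⊓-idem ⟦ a ⟧)
  axiom-sound (⌟-idem a)       = ⊑-reflexive (sym (⌟-⊔-idem ⟦ a ⟧))
  axiom-sound (⊓¬ a)           = ⊑-reflexive (⊓-¬ ⟦ a ⟧)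
  axiom-sound (⊔⌟ a)           = ⊑-reflexive (sym (⊔-⌟ ⟦ a ⟧))
  axiom-sound (¬¬-1 a b)       = ⊑-reflexive (¬¬-⊓ ⟦ a ⟧ ⟦ b ⟧)
  axiom-sound (¬¬-2 a b)       = ⊑-reflexive (sym (¬¬-⊓ ⟦ a ⟧ ⟦ b ⟧))
  axiom-sound (⌟⌟-1 a b)       = ⊑-reflexive (⌟⌟-⊔ ⟦ a ⟧ ⟦ b ⟧)
  axiom-sound (⌟⌟-2 a b)       = ⊑-reflexive (sym (⌟⌟-⊔ ⟦ a ⟧ ⟦ b ⟧))
  axiom-sound (abs-⊓⊔ a b)     = ⊑-reflexive (sym (⊓-abs-⊔ ⟦ a ⟧ ⟦ b ⟧))
  axiom-sound (abs-⊔⊓ a b)     = ⊑-reflexive (⊔-abs-⊓ ⟦ a ⟧ ⟦ b ⟧)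
  axiom-sound (abs-⊓∨ a b)     = ⊑-reflexive (sym (⊓-abs-∨ ⟦ a ⟧ ⟦ b ⟧))
  axiom-sound (abs-⊔∧ a b)     = ⊑-reflexive (⊔-abs-∧ ⟦ a ⟧ ⟦ b ⟧)
  axiom-sound (dist-∨-1 a b c) = ⊑-reflexive (⊓-distrib-∨ ⟦ a ⟧ ⟦ b ⟧ ⟦ c ⟧)
  axiom-sound (dist-∨-2 a b c) = ⊑-reflexive (sym (⊓-distrib-∨ ⟦ a ⟧ ⟦ b ⟧ ⟦ c ⟧))
  axiom-sound (dist-∧-1 a b c) = ⊑-reflexive (⊔-distrib-∧ ⟦ a ⟧ ⟦ b ⟧ ⟦ c ⟧)
  axiom-sound (dist-∧-2 a b c) = ⊑-reflexive (sym (⊔-distrib-∧ ⟦ a ⟧ ⟦ b ⟧ ⟦ c ⟧))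
  axiom-sound (⊥-ax a)         = ⊥-minimum ⟦ a ⟧
  axiom-sound (⊤-ax a)         = ⊤-maximum ⟦ a ⟧
  axiom-sound ¬⊤-ax            = ⊑-reflexive ¬⊤
  axiom-sound ⌟⊥-ax            = ⊑-reflexive (sym ⌟⊥)
  axiom-sound ¬⊥-1             = ⊑-reflexive ¬⊥
  axiom-sound ¬⊥-2             = ⊑-reflexive (sym ¬⊥)
  axiom-sound ⌟⊤-1             = ⊑-reflexive ⌟⊤
  axiom-sound ⌟⊤-2             = ⊑-reflexive (sym ⌟⊤)
  axiom-sound (mixed-1 a)      = ⊑-reflexive (sym (mixed ⟦ a ⟧))
  axiom-sound (mixed-2 a)      = ⊑-reflexive (mixed ⟦ a ⟧)
  axiom-sound (ov-1 n)         = ⊑-reflexive (Valuation.vo-⊓ v n)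
  axiom-sound (ov-2 n)         = ⊑-reflexive (sym (Valuation.vo-⊓ v n))
  axiom-sound (pv-1 n)         = ⊑-reflexive (Valuation.vp-⊔ v n)
  axiom-sound (pv-2 n)         = ⊑-reflexive (sym (Valuation.vp-⊔ v n))

  sp-sound : ∀ a → SatH 𝔻 v ((a ⊢ a ⊓ᶠ a) ∷ (a ⊔ᶠ a ⊢ a) ∷ [])
  sp-sound a = [ here ∘ ⊑-reflexive ∘ sym , there ∘ here ∘ ⊑-reflexive ]′ (pure ⟦ a ⟧)

  sound : ∀ {h} → Provable h → SatH 𝔻 v h
  sound (axiom ax)                   = here (axiom-sound ax)
  sound (sp a)                       = sp-sound a
  sound (mon-⊓ʳ {B} c p)             = replace B (⊓-monoˡ-⊑ ⟦ c ⟧) (sound p)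
  sound (mon-⊓ˡ {B} c p)             = replace B (⊓-monoʳ-⊑ ⟦ c ⟧) (sound p)
  sound (mon-⊔ʳ {B} c p)             = replace B (⊔-monoˡ-⊑ ⟦ c ⟧) (sound p)
  sound (mon-⊔ˡ {B} c p)             = replace B (⊔-monoʳ-⊑ ⟦ c ⟧) (sound p)
  sound (anti-¬ {B} p)               = replace B ¬-antitone (sound p)
  sound (anti-⌟ {B} p)               = replace B ⌟-antitone (sound p)
  sound (cut {B} {D = D} p q)        = merge B D ⊑-trans (sound p) (sound q)
  sound (⊑-intro {B} {D = D} {F = F} {H = H} p₁ p₂ p₃ p₄) =
    merge₄ B D F H ⊑-from-components (sound p₁) (sound p₂) (sound p₃) (sound p₄)
  sound (ext-contr {B} {D = D} p)    = contract B D (sound p)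
  sound (ext-exch {B} {D = D} {E} p) = exchange B D E (sound p)
  sound (ext-weak p)                 = ++⁺ˡ (sound p)

theorem35 : ∀ {ℓ : Level} (h : HSeq) → Provable h → Valid ℓ h
theorem35 h pr 𝔻 v = Soundness.sound 𝔻 v pr
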